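{- For every integer $k\ge3$, every satellite graph $S_{2k+1}$ satisfies the ACK property: there exists a nonzero $\{0,1\}$-vector in the row space over $\mathbb{R}$ of the adjacency matrix of $S_{2k+1}$ that is not one of its rows.
   Context: For an integer $k\ge3$, a satellite graph $S_{2k+1}$ is a simple graph on $2k+1$ vertices whose vertex set is partitioned into a single vertex $v_{\mathrm{dom}}$, a set $V_4=\{u_1,\dots,u_k\}$ and a set $V_2=\{w_1,\dots,w_k\}$, with edges: $v_{\mathrm{dom}}$ is adjacent to every other vertex; each vertex of $V_4$ is adjacent to exactly two vertices of $V_4$ and exactly one vertex of $V_2$; each vertex of $V_2$ is adjacent to exactly one vertex of $V_4$ (and to $v_{\mathrm{dom}}$); no other edges. -}

module Defs where

open import Data.Nat using (ℕ; zero; suc; _+_; _*_)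
open import Data.Bool using (Bool; true; false; if_then_else_)
open import Data.Fin using (Fin)

open import Data.List using (List; map; foldr; allFin)
open import Data.Sum using (_⊎_; inj₁; inj₂)
open import Data.Unit using (⊤; tt)
open import Data.Product using (Σ; ∃; _×_; _,_)
open import Relation.Binary.PropositionalEquality using (_≡_; _≢_)
open import Relation.Nullary using (¬_)
open import Function.Bundles using (_↔_; Inverse)
open import Data.Rational using (ℚ; 0ℚ; 1ℚ) renaming (_+_ to _+ℚ_; _*_ to _*ℚ_)

record SimpleGraph (n : ℕ) : Set where
  field
    adj   : Fin n → Fin n → Bool
    sym   : ∀ i j → adj i j ≡ adj j i
    irrefl : ∀ i → adj i i ≡ false
open SimpleGraph public

count : ∀ {m} → (Fin m → Bool) → ℕ
count {m} f = foldr (λ j acc → (if f j then 1 else 0) + acc) 0 (allFin m)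

-- S is a satellite graph S_{2k+1}: the vertex set Fin (2k+1) is partitioned
-- (via a bijection lab from ⊤ ⊎ (Fin k ⊎ Fin k)) into v_dom = lab (inj₁ tt),
-- V4 = { u i = lab (inj₂ (inj₁ i)) } and V2 = { w i = lab (inj₂ (inj₂ i)) },
-- with the edge conditions of the definition.
record IsSatellite (k : ℕ) (G : SimpleGraph (suc (k + k))) : Set where
  field
    lab : (⊤ ⊎ (Fin k ⊎ Fin k)) ↔ Fin (suc (k + k))
  vdom : Fin (suc (k + k))
  vdom = Inverse.to lab (inj₁ tt)
  u : Fin k → Fin (suc (k + k))
  u i = Inverse.to lab (inj₂ (inj₁ i))
  w : Fin k → Fin (suc (k + k))
  w i = Inverse.to lab (inj₂ (inj₂ i))
  field
    dom-adj : ∀ x → x ≢ vdom → adj G vdom x ≡ true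
    u-u : ∀ i → count (λ j → adj G (u i) (u j)) ≡ 2
    u-w : ∀ i → count (λ j → adj G (u i) (w j)) ≡ 1
    w-u : ∀ i → count (λ j → adj G (w i) (u j)) ≡ 1
    w-w : ∀ i j → adj G (w i) (w j) ≡ false

sumℚ : ∀ {n} → (Fin n → ℚ) → ℚ
sumℚ {n} f = foldr (λ j acc → f j +ℚ acc) 0ℚ (allFin n)

b2q : Bool → ℚ
b2q true = 1ℚ
b2q false = 0ℚ

adjMatrix : ∀ {n} → SimpleGraph n → Fin n → Fin n → ℚ
adjMatrix G i j = b2q (adj G i j)

InRowSpace : ∀ {n} → (Fin n → Fin n → ℚ) → (Fin n → ℚ) → Set
InRowSpace {n} M v = Σ (Fin n → ℚ) λ c → ∀ j → sumℚ (λ i → c i *ℚ M i j) ≡ v j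

ACK : ∀ {n} → SimpleGraph n → Set
ACK {n} G = Σ (Fin n → Bool) λ b →
    (∃ λ j → b j ≡ true)
  × InRowSpace (adjMatrix G) (λ j → b2q (b j))
  × (∀ i → ¬ (∀ j → b j ≡ adj G i j))

module Submission where

-- Take w ∈ V₂ and its unique V₄-neighbour uₐ, so N(w) = {v_dom, uₐ}, and a V₄-neighbour y of uₐ.
-- Then N(w) ⊆ N(y), so row y − row w is a {0,1}-vector in the row space. It vanishes at v_dom
-- and at uₐ, whereas every row except that of v_dom is 1 at v_dom and the row of v_dom is 1 at
-- uₐ; and it is 1 at the V₂-neighbour of y, so it is nonzero.

open import Defs hiding (sym)
open import Data.Nat using (ℕ; zero; suc; _+_; _≥_)
open import Data.Nat.Properties using (suc-injective)
open import Data.Fin using (Fin; zero; suc; _≟_)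
open import Data.Bool using (Bool; true; false; if_then_else_; _∧_; not)
open import Data.Sum using (inj₁; inj₂)
open import Data.Unit using (tt)
open import Data.Product using (∃; _,_)
import Data.Product as Product
open import Data.List using (foldr; allFin)
open import Data.List.Properties using (map-tabulate; foldr-map)
open import Data.Rational using (ℚ; 0ℚ; 1ℚ) renaming (_+_ to _+ℚ_; _*_ to _*ℚ_; _-_ to _-ℚ_)
import Data.Rational.Properties as ℚ
open import Data.Rational.Solver using (module +-*-Solver)
open import Algebra.Properties.CommutativeMonoid.Sum ℚ.+-0-commutativeMonoid
  using (sum; sum-cong-≗; sum-replicate-zero)
open import Function using (_∘_; id; Inverse; Injection)
open import Function.Properties.Inverse using (↔⇒↣)
open import Relation.Binary.PropositionalEquality
open import Relation.Nullary using (¬_; yes; no)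

foldr-allFin-suc : ∀ {b} {B : Set b} {n} (c : Fin (suc n) → B → B) (e : B) →
                   foldr c e (allFin (suc n)) ≡ c zero (foldr (c ∘ suc) e (allFin n))
foldr-allFin-suc {n = n} c e =
  cong (c zero) (trans (cong (foldr c e) (sym (map-tabulate id suc))) (foldr-map c suc e (allFin n)))

count-suc : ∀ {n} (f : Fin (suc n) → Bool) → count f ≡ (if f zero then 1 else 0) + count (f ∘ suc)
count-suc f = foldr-allFin-suc (λ j acc → (if f j then 1 else 0) + acc) 0

count≡suc⇒∃ : ∀ {n} (f : Fin n → Bool) {c} → count f ≡ suc c → ∃ λ j → f j ≡ true
count≡suc⇒∃ {zero}  f ()
count≡suc⇒∃ {suc n} f e rewrite count-suc f with f zero in f₀
... | true  = zero , f₀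
... | false = Product.map suc id (count≡suc⇒∃ (f ∘ suc) e)

count≡0⇒false : ∀ {n} (f : Fin n → Bool) → count f ≡ 0 → ∀ j → f j ≡ false
count≡0⇒false {suc n} f e j rewrite count-suc f with f zero in f₀
count≡0⇒false {suc n} f e zero    | false = f₀
count≡0⇒false {suc n} f e (suc j) | false = count≡0⇒false (f ∘ suc) e j

count≡1⇒unique : ∀ {n} (f : Fin n → Bool) → count f ≡ 1 →
                 ∀ i j → f i ≡ true → f j ≡ true → i ≡ j
count≡1⇒unique {suc n} f e i j fi fj rewrite count-suc f with f zero in f₀
count≡1⇒unique {suc n} f e zero    zero    fi fj | _     = refl
count≡1⇒unique {suc n} f e (suc i) (suc j) fi fj | false = cong suc (count≡1⇒unique (f ∘ suc) e i j fi fj)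
count≡1⇒unique {suc n} f e zero    (suc j) fi fj | false with () ← trans (sym fi) f₀
count≡1⇒unique {suc n} f e (suc i) _       fi fj | true
  with () ← trans (sym fi) (count≡0⇒false (f ∘ suc) (suc-injective e) i)
count≡1⇒unique {suc n} f e _       (suc j) fi fj | true
  with () ← trans (sym fj) (count≡0⇒false (f ∘ suc) (suc-injective e) j)
count≡1⇒unique {suc n} f e (suc i) zero    fi fj | false with () ← trans (sym fj) f₀

sumℚ≡sum : ∀ {n} (f : Fin n → ℚ) → sumℚ f ≡ sum f
sumℚ≡sum {zero}  f = refl
sumℚ≡sum {suc n} f = trans (foldr-allFin-suc (λ j acc → f j +ℚ acc) 0ℚ) (cong (f zero +ℚ_) (sumℚ≡sum (f ∘ suc)))

δ : ∀ {n} → Fin n → Fin n → ℚ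
δ zero    zero    = 1ℚ
δ zero    (suc _) = 0ℚ
δ (suc _) zero    = 0ℚ
δ (suc x) (suc i) = δ x i

sum-δ : ∀ {n} (x : Fin n) (f : Fin n → ℚ) → sum (λ i → δ x i *ℚ f i) ≡ f x
sum-δ {suc n} zero f = begin
  1ℚ *ℚ f zero +ℚ sum (λ i → 0ℚ *ℚ f (suc i))
    ≡⟨ cong₂ _+ℚ_ (ℚ.*-identityˡ (f zero)) (sum-cong-≗ (ℚ.*-zeroˡ ∘ f ∘ suc)) ⟩
  f zero +ℚ sum {n} (λ _ → 0ℚ)
    ≡⟨ cong (f zero +ℚ_) (sum-replicate-zero n) ⟩
  f zero +ℚ 0ℚ
    ≡⟨ ℚ.+-identityʳ (f zero) ⟩
  f zero
    ∎
  where open ≡-Reasoning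
sum-δ {suc n} (suc x) f = begin
  0ℚ *ℚ f zero +ℚ sum (λ i → δ x i *ℚ f (suc i))
    ≡⟨ cong₂ _+ℚ_ (ℚ.*-zeroˡ (f zero)) (sum-δ x (f ∘ suc)) ⟩
  0ℚ +ℚ f (suc x)
    ≡⟨ ℚ.+-identityˡ (f (suc x)) ⟩
  f (suc x)
    ∎
  where open ≡-Reasoning

open +-*-Solver

sum-minus : ∀ {n} (f g : Fin n → ℚ) → sum (λ i → f i -ℚ g i) ≡ sum f -ℚ sum g
sum-minus {zero}  f g = refl
sum-minus {suc n} f g = trans (cong (f zero -ℚ g zero +ℚ_) (sum-minus (f ∘ suc) (g ∘ suc)))
  (solve 4 (λ a b c d → (a :- b) :+ (c :- d) := (a :+ c) :- (b :+ d)) refl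
     (f zero) (g zero) (sum (f ∘ suc)) (sum (g ∘ suc)))

sum-δ-difference : ∀ {n} (x y : Fin n) (f : Fin n → ℚ) →
                   sum (λ i → (δ x i -ℚ δ y i) *ℚ f i) ≡ f x -ℚ f y
sum-δ-difference x y f = begin
  sum (λ i → (δ x i -ℚ δ y i) *ℚ f i)
    ≡⟨ sum-cong-≗ (λ i → *-distribʳ-minus (δ x i) (δ y i) (f i)) ⟩
  sum (λ i → δ x i *ℚ f i -ℚ δ y i *ℚ f i)
    ≡⟨ sum-minus (λ i → δ x i *ℚ f i) (λ i → δ y i *ℚ f i) ⟩
  sum (λ i → δ x i *ℚ f i) -ℚ sum (λ i → δ y i *ℚ f i)
    ≡⟨ cong₂ _-ℚ_ (sum-δ x f) (sum-δ y f) ⟩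
  f x -ℚ f y
    ∎
  where
  open ≡-Reasoning
  *-distribʳ-minus : ∀ a b c → (a -ℚ b) *ℚ c ≡ a *ℚ c -ℚ b *ℚ c
  *-distribʳ-minus = solve 3 (λ a b c → (a :- b) :* c := a :* c :- b :* c) refl

b2q-∧-not : ∀ p q → (q ≡ true → p ≡ true) → b2q (p ∧ not q) ≡ b2q p -ℚ b2q q
b2q-∧-not true  true  _ = refl
b2q-∧-not true  false _ = refl
b2q-∧-not false false _ = refl
b2q-∧-not false true  q⇒p with () ← q⇒p refl

row-difference-inRowSpace : ∀ {n} (G : SimpleGraph n) (x y : Fin n) →
                            (∀ j → adj G y j ≡ true → adj G x j ≡ true) →
                            InRowSpace (adjMatrix G) (λ j → b2q (adj G x j ∧ not (adj G y j)))
row-difference-inRowSpace G x y N[y]⊆N[x] = c , λ j → begin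
  sumℚ (λ i → c i *ℚ adjMatrix G i j)
    ≡⟨ sumℚ≡sum (λ i → c i *ℚ adjMatrix G i j) ⟩
  sum (λ i → c i *ℚ adjMatrix G i j)
    ≡⟨ sum-δ-difference x y (λ i → adjMatrix G i j) ⟩
  adjMatrix G x j -ℚ adjMatrix G y j
    ≡⟨ b2q-∧-not (adj G x j) (adj G y j) (N[y]⊆N[x] j) ⟨
  b2q (adj G x j ∧ not (adj G y j))
    ∎
  where
  open ≡-Reasoning
  c : Fin _ → ℚ
  c i = δ x i -ℚ δ y i

zero-on-dominating-edge⇒¬row : ∀ {n} (G : SimpleGraph n) (d : Fin n) → (∀ x → x ≢ d → adj G d x ≡ true) →
                               (b : Fin n → Bool) (v : Fin n) → v ≢ d → b d ≡ false → b v ≡ false →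
                               ∀ i → ¬ (∀ j → b j ≡ adj G i j)
zero-on-dominating-edge⇒¬row G d dominating b v v≢d bd bv i b≡row with i ≟ d
... | yes refl with () ← trans (sym bv) (trans (b≡row v) (dominating v v≢d))
... | no i≢d   with () ← trans (sym bd) (trans (b≡row d) (trans (SimpleGraph.sym G i d) (dominating i i≢d)))

module Satellite {k} {G : SimpleGraph (suc (k + k))} (S : IsSatellite k G) where
  open IsSatellite S

  lab-injective : ∀ {ℓ ℓ′} → Inverse.to lab ℓ ≡ Inverse.to lab ℓ′ → ℓ ≡ ℓ′
  lab-injective = Injection.injective (↔⇒↣ lab)

  u≢vdom : ∀ i → u i ≢ vdom
  u≢vdom i e with () ← lab-injective e

  w≢vdom : ∀ i → w i ≢ vdom
  w≢vdom i e with () ← lab-injective e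

  adj-vdom : ∀ x → x ≢ vdom → adj G x vdom ≡ true
  adj-vdom x x≢vdom = trans (SimpleGraph.sym G x vdom) (dom-adj x x≢vdom)

  w-neighbourhood⊆ : ∀ i a y → adj G (w i) (u a) ≡ true → y ≢ vdom → adj G y (u a) ≡ true →
                     ∀ x → adj G (w i) x ≡ true → adj G y x ≡ true
  w-neighbourhood⊆ i a y wᵢuₐ y≢vdom yuₐ x wᵢx =
    neighbour (Inverse.from lab x) (Inverse.strictlyInverseˡ lab x) wᵢx
    where
    neighbour : ∀ ℓ {x} → Inverse.to lab ℓ ≡ x → adj G (w i) x ≡ true → adj G y x ≡ true
    neighbour (inj₁ tt)        refl _    = adj-vdom y y≢vdom
    neighbour (inj₂ (inj₁ a′)) refl wᵢuₐ′
      rewrite count≡1⇒unique (λ j → adj G (w i) (u j)) (w-u i) a′ a wᵢuₐ′ wᵢuₐ = yuₐ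
    neighbour (inj₂ (inj₂ j))  refl wᵢwⱼ with () ← trans (sym wᵢwⱼ) (w-w i j)

  ack-of-path : ∀ i a y t → adj G (w i) (u a) ≡ true → y ≢ vdom → adj G y (u a) ≡ true →
                adj G y (w t) ≡ true → ACK G
  ack-of-path i a y t wᵢuₐ y≢vdom yuₐ ywₜ =
    b , (w t , bwₜ) , row-difference-inRowSpace G y (w i) (w-neighbourhood⊆ i a y wᵢuₐ y≢vdom yuₐ)
      , zero-on-dominating-edge⇒¬row G vdom dom-adj b (u a) (u≢vdom a) bvdom buₐ
    where
    b : Fin (suc (k + k)) → Bool
    b j = adj G y j ∧ not (adj G (w i) j)
    bwₜ : b (w t) ≡ true
    bwₜ = cong₂ (λ p q → p ∧ not q) ywₜ (w-w i t)
    bvdom : b vdom ≡ false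
    bvdom = cong₂ (λ p q → p ∧ not q) (adj-vdom y y≢vdom) (adj-vdom (w i) (w≢vdom i))
    buₐ : b (u a) ≡ false
    buₐ = cong₂ (λ p q → p ∧ not q) yuₐ wᵢuₐ

  ack : Fin k → ACK G
  ack i =
    let a , wᵢuₐ = count≡suc⇒∃ (λ j → adj G (w i) (u j)) (w-u i)
        a′ , uₐuₐ′ = count≡suc⇒∃ (λ j → adj G (u a) (u j)) (u-u a)
        t , uₐ′wₜ = count≡suc⇒∃ (λ j → adj G (u a′) (w j)) (u-w a′)
    in ack-of-path i a (u a′) t wᵢuₐ (u≢vdom a′) (trans (SimpleGraph.sym G (u a′) (u a)) uₐuₐ′) uₐ′wₜ

-- Only V₂ ≠ ∅, i.e. k ≥ 1, is used.
theorem4p4 : (k : ℕ) → k ≥ 3 → (G : SimpleGraph (suc (k + k))) → IsSatellite k G → ACK G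
theorem4p4 (suc k) _ G S = Satellite.ack S zero
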